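{- Let $q_1,q_2$ be distinct primes, and for integers $s,t \geq 1$ let $$Q(q_1,q_2,s,t)=q_1^{3(s-1)}q_2^{3(t-1)}\,\frac{q_1(q_1-1)(q_1+1)}{2}\,\frac{q_2(q_2-1)(q_2+1)}{2}.$$ Then for every large integer $n$ there are positive integers $s,t$ such that $n \leq Q(q_1,q_2,s,t) \leq n+o(n)$; that is, for every $\mu>0$ there is $n_0$ such that for every integer $n \geq n_0$ there exist integers $s,t\geq 1$ with $n \leq Q(q_1,q_2,s,t) \leq (1+\mu)n$.
   Formalization: The tolerance μ ranges only over the positive rationals. -}

module Defs where

open import Data.Nat using (ℕ; suc; _*_; _∸_; _^_; _+_; _/_)

-- q(q-1)(q+1)/2 ; exact for every natural q since (q-1)q(q+1) is even
halfTriple : ℕ → ℕ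
halfTriple q = (q * (q ∸ 1) * (q + 1)) / 2

Q : ℕ → ℕ → ℕ → ℕ → ℕ
Q q₁ q₂ s t = q₁ ^ (3 * (s ∸ 1)) * q₂ ^ (3 * (t ∸ 1)) * halfTriple q₁ * halfTriple q₂

-- Put X = q₁³, Y = q₂³ and ρ = 1 + μ. No positive power of X is a power of Y, so a pigeonhole
-- argument on which band [ρ^k, ρ^(k+1)) contains X^a / Y^⌊log_Y X^a⌋ yields powers W, Z of X
-- and Y (in some order) with Z < W ≤ ρ Z. For large n choose N with C Z^N ≤ n ≤ C W^N, where
-- C = q₁(q₁²-1)/2 · q₂(q₂²-1)/2; trading the factors Z of C Z^N for W one at a time multiplies
-- by at most ρ, so the first product reaching n is at most ρ n, and each C W^k Z^l is a value of Q.

module Submission where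

open import Defs
open import Data.Nat using (ℕ; zero; suc; _+_; _*_; _^_; _∸_; _≤_; _<_; _≥_; _≤?_; _<?_; z≤n; s≤s; >-nonZero; nonTrivial⇒≢1; nonTrivial⇒n>1)
open import Data.Nat.Properties
open import Data.Nat.Tactic.RingSolver using (solve-∀)
open import Data.Nat.Divisibility using (_∣_; ∣1⇒≡1; m∣m*n)
open import Data.Nat.DivMod using (m≥n⇒m/n>0)
open import Data.Nat.Primality using (Prime; euclidsLemma; prime⇒irreducible; prime⇒nonTrivial)
open import Data.Fin using (toℕ; fromℕ<)
open import Data.Fin.Properties using (pigeonhole; toℕ-fromℕ<)
open import Data.Product using (∃-syntax; ∃₂; _×_; _,_; proj₁; proj₂)
open import Data.Sum using (_⊎_; inj₁; inj₂)
open import Data.Empty using (⊥-elim)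
open import Relation.Nullary using (¬_; yes; no)
open import Relation.Unary using (Decidable)
open import Relation.Binary using (tri<; tri≈; tri>)
open import Relation.Binary.PropositionalEquality
open import Data.Integer as ℤ using (+_; +0; -[1+_])
import Data.Integer.Properties as ℤ
open import Data.Rational as ℚ using (ℚ; Positive; 1ℚ; _/_; mkℚ; toℚᵘ)
open import Data.Rational.Properties using (normalize-coprime; toℚᵘ-cancel-≤; toℚᵘ-homo-*; toℚᵘ-homo-+)
import Data.Rational.Unnormalised as ℚᵘ
import Data.Rational.Unnormalised.Properties as ℚᵘ
open import Data.Nat.Coprimality using (Coprime; 1-coprimeTo) renaming (sym to coprime-sym)

-- (1 + p/d)^N ≥ 1 + N p/d, multiplied through by d^(N+1)
bernoulli : ∀ d p N → d ^ N * (d + N * p) ≤ d * (d + p) ^ N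
bernoulli d p zero = ≤-reflexive (trans (+-identityʳ (d + 0)) (trans (+-identityʳ d) (sym (*-identityʳ d))))
bernoulli d p (suc N) = begin
  d * d ^ N * (d + (p + N * p))                          ≡⟨ expand d p (d ^ N) (N * p) ⟩
  d * (d ^ N * (d + N * p)) + p * (d ^ N * d)            ≤⟨ +-monoʳ-≤ _ (*-monoʳ-≤ p (*-monoʳ-≤ (d ^ N) (m≤m+n d (N * p)))) ⟩
  d * (d ^ N * (d + N * p)) + p * (d ^ N * (d + N * p))  ≡⟨ *-distribʳ-+ _ d p ⟨
  (d + p) * (d ^ N * (d + N * p))                        ≤⟨ *-monoʳ-≤ (d + p) (bernoulli d p N) ⟩
  (d + p) * (d * (d + p) ^ N)                            ≡⟨ swap (d + p) d _ ⟩
  d * ((d + p) * (d + p) ^ N)                            ∎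
  where
  open ≤-Reasoning
  expand : ∀ d p A M → d * A * (d + (p + M)) ≡ d * (A * (d + M)) + p * (A * d)
  expand = solve-∀
  swap : ∀ a b c → a * (b * c) ≡ b * (a * c)
  swap = solve-∀

1≤^ : ∀ {m} n → 1 ≤ m → 1 ≤ m ^ n
1≤^ {m} n 1≤m = m^n>0 m {{>-nonZero 1≤m}} n

n<m^n : ∀ {m} n → 2 ≤ m → n < m ^ n
n<m^n {suc (suc w)} n (s≤s (s≤s _)) = begin-strict
  n                        <⟨ s≤s (m≤m*n n (suc w)) ⟩
  1 + n * suc w            ≡⟨ *-identityˡ _ ⟨
  1 * (1 + n * suc w)      ≡⟨ cong (_* (1 + n * suc w)) (^-zeroˡ n) ⟨
  1 ^ n * (1 + n * suc w)  ≤⟨ bernoulli 1 (suc w) n ⟩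
  1 * suc (suc w) ^ n      ≡⟨ *-identityˡ _ ⟩
  suc (suc w) ^ n          ∎
  where open ≤-Reasoning

-- By Bernoulli, (1 + 1/z)^N ≥ 1 + N/z ≥ z.
^-suc≤^ : ∀ {z w} N → 1 ≤ z → z < w → z * z ≤ N → z ^ suc N ≤ w ^ N
^-suc≤^ {z@(suc _)} {w} N _ z<w z²≤N = *-cancelˡ-≤ z (begin
  z * (z * z ^ N)   ≡⟨ rearrange z (z ^ N) ⟩
  z ^ N * (z * z)   ≤⟨ *-monoʳ-≤ (z ^ N) (≤-trans z²≤N (≤-trans (m≤n+m N z) (+-monoʳ-≤ z (m≤m*n N 1)))) ⟩
  z ^ N * (z + N * 1) ≤⟨ bernoulli z 1 N ⟩
  z * (z + 1) ^ N   ≤⟨ *-monoʳ-≤ z (^-monoˡ-≤ N (≤-trans (≤-reflexive (+-comm z 1)) z<w)) ⟩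
  z * w ^ N         ∎)
  where
  open ≤-Reasoning
  rearrange : ∀ z A → z * (z * A) ≡ A * (z * z)
  rearrange = solve-∀

crossing : ∀ {P : ℕ → Set} → Decidable P → ∀ M → P 0 → ¬ P M → ∃[ k ] k < M × P k × ¬ P (suc k)
crossing P? zero P0 ¬PM = ⊥-elim (¬PM P0)
crossing P? (suc M) P0 ¬PsM with P? M
... | yes PM = M , n<1+n M , PM , ¬PsM
... | no ¬PM with crossing P? M P0 ¬PM
...   | k , k<M , Pk , ¬Psk = k , m<n⇒m<1+n k<M , Pk , ¬Psk

power-bracket : ∀ {y} v → 2 ≤ y → 1 ≤ v → ∃[ b ] y ^ b ≤ v × v < y ^ suc b
power-bracket {y} v 2≤y 1≤v with crossing (λ b → y ^ b ≤? v) v 1≤v (<⇒≱ (n<m^n v 2≤y))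
... | b , _ , yᵇ≤v , yᵇ⁺¹≰v = b , yᵇ≤v , ≰⇒> yᵇ⁺¹≰v

-- x ∈ [n, (1 + p/d) n]: ratios 1 + μ are kept as pairs d, p of naturals throughout.
record Within (d p n x : ℕ) : Set where
  constructor within
  field
    above : n ≤ x
    bounded : d * x ≤ (d + p) * n

record CloseAbove (d p z w : ℕ) : Set where
  constructor close-above
  field
    above : z < w
    bounded : d * w ≤ (d + p) * z

replace-step : ∀ {d p z w} → d * w ≤ (d + p) * z → ∀ C Z → d * (C * (w ^ 1 * Z)) ≤ (d + p) * (C * (z * Z))
replace-step {d} {p} {z} {w} step C Z = begin
  d * (C * (w ^ 1 * Z))   ≡⟨ pull-out d C w Z ⟩
  d * w * (C * Z)         ≤⟨ *-monoˡ-≤ (C * Z) step ⟩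
  (d + p) * z * (C * Z)   ≡⟨ push-in (d + p) z C Z ⟩
  (d + p) * (C * (z * Z)) ∎
  where
  open ≤-Reasoning
  pull-out : ∀ d C w Z → d * (C * (w * 1 * Z)) ≡ d * w * (C * Z)
  pull-out = solve-∀
  push-in : ∀ e z C Z → e * z * (C * Z) ≡ e * (C * (z * Z))
  push-in = solve-∀

-- Trading one factor z for w multiplies by at most 1 + p/d, so along the way from C z^N
-- to C w^N the first term reaching n exceeds it by at most that ratio.
walk : ∀ {d p z w} → d * w ≤ (d + p) * z → ∀ N C {n} → C * z ^ N ≤ n → n ≤ C * w ^ N →
       ∃₂ λ k l → Within d p n (C * (w ^ k * z ^ l))
walk {d} {p} _ zero C lo hi = 0 , 0 , within hi (*-mono-≤ (m≤m+n d p) lo)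
walk {d} {p} {z} {w} step (suc N) C {n} lo hi with n ≤? C * (w ^ 1 * z ^ N)
... | yes n≤ = 1 , N , within n≤ (≤-trans (replace-step {d} {p} step C (z ^ N)) (*-monoʳ-≤ (d + p) lo))
... | no n≰ =
  let k , l , x-within = walk step N (C * w) (subst (_≤ n) (regroup C w (z ^ N)) (<⇒≤ (≰⇒> n≰)))
                                          (subst (n ≤_) (sym (*-assoc C w (w ^ N))) hi)
  in suc k , l , subst (Within d p n) (regroup′ C w (w ^ k) (z ^ l)) x-within
  where
  regroup : ∀ C w Z → C * (w * 1 * Z) ≡ C * w * Z
  regroup = solve-∀
  regroup′ : ∀ C w A B → C * w * (A * B) ≡ C * (w * A * B)
  regroup′ = solve-∀

-- N is the least index ≥ z² with n ≤ C w^N; past z², the previous index gives C z^N ≤ n by ^-suc≤^.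
bracket : ∀ {C z w} → 1 ≤ C → 1 ≤ z → z < w → ∀ n → C * z ^ (z * z) ≤ n →
          ∃[ N ] C * z ^ N ≤ n × n ≤ C * w ^ N
bracket {C} {z} {w} 1≤C 1≤z z<w n n≥ with n ≤? C * w ^ (z * z)
... | yes n≤ = z * z , n≥ , n≤
... | no n≰ with crossing (λ i → C * w ^ (i + z * z) <? n) n (≰⇒> n≰) (≤⇒≯ n≤Cwⁿ)
  where
  n≤Cwⁿ : n ≤ C * w ^ (n + z * z)
  n≤Cwⁿ = ≤-trans (<⇒≤ (n<m^n n (≤-trans (s≤s 1≤z) z<w)))
                  (≤-trans (^-monoʳ-≤ w {{>-nonZero (<-≤-trans (s≤s z≤n) z<w)}} (m≤m+n n (z * z)))
                           (m≤n*m _ C {{>-nonZero 1≤C}}))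
... | k , _ , below , ¬below = suc (k + z * z) , <⇒≤ (≤-<-trans lower-step below) , ≮⇒≥ ¬below
  where
  lower-step : C * z ^ suc (k + z * z) ≤ C * w ^ (k + z * z)
  lower-step = *-monoʳ-≤ C (^-suc≤^ (k + z * z) 1≤z z<w (m≤n+m (z * z) k))

eventually-within : ∀ {d p z w} C → 1 ≤ C → 1 ≤ z → CloseAbove d p z w →
  ∀ n → C * z ^ (z * z) ≤ n → ∃₂ λ k l → Within d p n (C * (w ^ k * z ^ l))
eventually-within C 1≤C 1≤z (close-above z<w step) n n≥ =
  let N , lo , hi = bracket 1≤C 1≤z z<w n n≥ in walk step N C lo hi

-- v/u lies in [ρ^k, ρ^(k+1)) for ρ = 1 + p/d
record InBand (d p k u v : ℕ) : Set where
  constructor in-band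
  field
    lower : (d + p) ^ k * u ≤ d ^ k * v
    upper : d ^ suc k * v < (d + p) ^ suc k * u

-- ρ^(dy+1) > y, since (1 + p/d)^(dy+1) ≥ 1 + (dy+1) p/d
ρ^-exceeds : ∀ {d p} y → 1 ≤ d → 1 ≤ p → d ^ suc (d * y) * y ≤ (d + p) ^ suc (d * y)
ρ^-exceeds {d@(suc _)} {p} y _ 1≤p = *-cancelˡ-≤ d (begin
  d * (d ^ M * y)       ≡⟨ x*[y*z]≡y*[x*z] d (d ^ M) y ⟩
  d ^ M * (d * y)       ≤⟨ *-monoʳ-≤ (d ^ M) (≤-trans (n≤1+n (d * y)) (≤-trans (m≤m*n M p {{>-nonZero 1≤p}}) (m≤n+m (M * p) d))) ⟩
  d ^ M * (d + M * p)   ≤⟨ bernoulli d p M ⟩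
  d * (d + p) ^ M       ∎)
  where
  M = suc (d * y)
  open ≤-Reasoning
  x*[y*z]≡y*[x*z] : ∀ a b c → a * (b * c) ≡ b * (a * c)
  x*[y*z]≡y*[x*z] = solve-∀

band-exists : ∀ {d p y u v} → 1 ≤ d → 1 ≤ p → u ≤ v → v < y * u →
              ∃[ k ] k < suc (d * y) × InBand d p k u v
band-exists {d} {p} {y} {u} {v} 1≤d 1≤p u≤v v<yu
  with crossing (λ k → (d + p) ^ k * u ≤? d ^ k * v) (suc (d * y)) (*-monoʳ-≤ 1 u≤v) ¬top
  where
  M = suc (d * y)
  ¬top : ¬ ((d + p) ^ M * u ≤ d ^ M * v)
  ¬top = <⇒≱ (begin-strict
    d ^ M * v         <⟨ *-monoʳ-< (d ^ M) {{>-nonZero (1≤^ M 1≤d)}} v<yu ⟩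
    d ^ M * (y * u)   ≡⟨ *-assoc (d ^ M) y u ⟨
    d ^ M * y * u     ≤⟨ *-monoˡ-≤ u (ρ^-exceeds y 1≤d 1≤p) ⟩
    (d + p) ^ M * u   ∎)
    where open ≤-Reasoning
... | k , k<M , lower , ¬upper = k , k<M , in-band lower (≰⇒> ¬upper)

band-ratio : ∀ {d p k u v u′ v′} → 1 ≤ d → 1 ≤ u → InBand d p k u v → InBand d p k u′ v′ →
             d * (v′ * u) < (d + p) * (u′ * v)
band-ratio {d} {p} {k} {u} {v} {u′} {v′} 1≤d 1≤u (in-band lower _) (in-band _ upper′) =
  *-cancelˡ-< (d ^ k * (d + p) ^ k) _ _ (begin-strict
    d ^ k * (d + p) ^ k * (d * (v′ * u))      ≡⟨ regroup d (d ^ k) ((d + p) ^ k) v′ u ⟩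
    d ^ suc k * v′ * ((d + p) ^ k * u)        <⟨ *-monoˡ-< ((d + p) ^ k * u) {{>-nonZero 1≤ρᵏu}} upper′ ⟩
    (d + p) ^ suc k * u′ * ((d + p) ^ k * u)  ≤⟨ *-monoʳ-≤ ((d + p) ^ suc k * u′) lower ⟩
    (d + p) ^ suc k * u′ * (d ^ k * v)        ≡⟨ regroup′ (d + p) ((d + p) ^ k) (d ^ k) u′ v ⟨
    d ^ k * (d + p) ^ k * ((d + p) * (u′ * v)) ∎)
  where
  open ≤-Reasoning
  1≤ρᵏu : 1 ≤ (d + p) ^ k * u
  1≤ρᵏu = *-mono-≤ (1≤^ k (≤-trans 1≤d (m≤m+n d p))) 1≤u
  regroup : ∀ a A B s t → A * B * (a * (s * t)) ≡ a * A * s * (B * t)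
  regroup = solve-∀
  regroup′ : ∀ a A B s t → B * A * (a * (s * t)) ≡ a * A * s * (B * t)
  regroup′ = solve-∀

same-band⇒near : ∀ {d p k u v X Y} → 1 ≤ d → 1 ≤ u → 1 ≤ v → 1 ≤ Y →
  InBand d p k u v → InBand d p k (u * Y) (v * X) →
  d * X < (d + p) * Y × d * Y < (d + p) * X
same-band⇒near {d} {p} {k} {u} {v} {X} {Y} 1≤d 1≤u 1≤v 1≤Y band band′ =
  *-cancelˡ-< (u * v) _ _ (subst₂ _<_ (factor₁ d u v X) (factor₂ (d + p) u v Y)
    (band-ratio 1≤d 1≤u band band′)) ,
  *-cancelˡ-< (u * v) _ _ (subst₂ _<_ (factor₃ d u v Y) (factor₄ (d + p) u v X)
    (band-ratio 1≤d (*-mono-≤ 1≤u 1≤Y) band′ band))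
  where
  factor₁ : ∀ a u v W → a * (v * W * u) ≡ u * v * (a * W)
  factor₁ = solve-∀
  factor₂ : ∀ a u v W → a * (u * W * v) ≡ u * v * (a * W)
  factor₂ = solve-∀
  factor₃ : ∀ a u v W → a * (v * (u * W)) ≡ u * v * (a * W)
  factor₃ = solve-∀
  factor₄ : ∀ a u v W → a * (u * (v * W)) ≡ u * v * (a * W)
  factor₄ = solve-∀

near⇒close : ∀ {d p X Y} → X ≢ Y → d * X < (d + p) * Y × d * Y < (d + p) * X →
             CloseAbove d p Y X ⊎ CloseAbove d p X Y
near⇒close {X = X} {Y} X≢Y (X<ρY , Y<ρX) with <-cmp X Y
... | tri< X<Y _ _ = inj₂ (close-above X<Y (<⇒≤ Y<ρX))
... | tri≈ _ X≡Y _ = ⊥-elim (X≢Y X≡Y)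
... | tri> _ _ Y<X = inj₁ (close-above Y<X (<⇒≤ X<ρY))

PowersDistinct : ℕ → ℕ → Set
PowersDistinct x y = ∀ m e → 1 ≤ m → x ^ m ≢ y ^ e

^-split : ∀ x {a a′} → a ≤ a′ → x ^ a′ ≡ x ^ a * x ^ (a′ ∸ a)
^-split x {a} {a′} a≤a′ = trans (cong (x ^_) (sym (m+[n∸m]≡n a≤a′))) (^-distribˡ-+-* x a (a′ ∸ a))

same-band⇒close : ∀ {d p k x y a a′ b b′} → 1 ≤ d → 1 ≤ x → 1 ≤ y → PowersDistinct x y → a < a′ →
  y ^ b ≤ x ^ a → x ^ a′ < y ^ suc b′ →
  InBand d p k (y ^ b) (x ^ a) → InBand d p k (y ^ b′) (x ^ a′) →
  ∃₂ λ m e → CloseAbove d p (y ^ e) (x ^ m) ⊎ CloseAbove d p (x ^ m) (y ^ e)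
same-band⇒close {d} {p} {k} {x} {y} {a} {a′} {b} {b′} 1≤d 1≤x 1≤y distinct a<a′ yᵇ≤xᵃ xᵃ′<yᵇ′⁺¹ band band′ =
  m , e , near⇒close (distinct m e (m<n⇒0<n∸m a<a′))
    (same-band⇒near 1≤d (1≤^ b 1≤y) (1≤^ a 1≤x) (1≤^ e 1≤y) band
      (subst₂ (InBand d p k) (^-split y b≤b′) (^-split x (<⇒≤ a<a′)) band′))
  where
  m = a′ ∸ a
  e = b′ ∸ b
  b≤b′ : b ≤ b′
  b≤b′ = ≮⇒≥ λ b′<b → <⇒≱ xᵃ′<yᵇ′⁺¹ (begin
    y ^ suc b′  ≤⟨ ^-monoʳ-≤ y {{>-nonZero 1≤y}} b′<b ⟩
    y ^ b       ≤⟨ yᵇ≤xᵃ ⟩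
    x ^ a       ≤⟨ ^-monoʳ-≤ x {{>-nonZero 1≤x}} (<⇒≤ a<a′) ⟩
    x ^ a′      ∎)
    where open ≤-Reasoning

pigeonholeℕ : ∀ B (f : ℕ → ℕ) → (∀ a → f a < B) → ∃₂ λ a a′ → a < a′ × f a ≡ f a′
pigeonholeℕ B f f<B with pigeonhole (n<1+n B) (λ a → fromℕ< (f<B (toℕ a)))
... | i , j , i<j , same = toℕ i , toℕ j , i<j , fromℕ<-injective (f<B (toℕ i)) (f<B (toℕ j)) same
  where
  fromℕ<-injective : ∀ {m n} (m<B : m < B) (n<B : n < B) → fromℕ< m<B ≡ fromℕ< n<B → m ≡ n
  fromℕ<-injective m<B n<B eq = trans (sym (toℕ-fromℕ< m<B)) (trans (cong toℕ eq) (toℕ-fromℕ< n<B))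

-- Pigeonhole over the band index k ≤ d y of x^a / y^⌊log_y x^a⌋ for a = 0, …, d y + 1.
close-powers : ∀ {x y} d p → 2 ≤ x → 2 ≤ y → 1 ≤ d → 1 ≤ p → PowersDistinct x y →
  ∃₂ λ m e → CloseAbove d p (y ^ e) (x ^ m) ⊎ CloseAbove d p (x ^ m) (y ^ e)
close-powers {x} {y} d p 2≤x 2≤y 1≤d 1≤p distinct = conclude (pigeonholeℕ (suc (d * y)) index index<bound)
  where
  floor : ∀ a → ∃[ b ] y ^ b ≤ x ^ a × x ^ a < y ^ suc b
  floor a = power-bracket (x ^ a) 2≤y (1≤^ a (<⇒≤ 2≤x))
  band : ∀ a → ∃[ k ] k < suc (d * y) × InBand d p k (y ^ proj₁ (floor a)) (x ^ a)
  band a = band-exists 1≤d 1≤p (proj₁ (proj₂ (floor a))) (proj₂ (proj₂ (floor a)))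
  index : ℕ → ℕ
  index a = proj₁ (band a)
  index<bound : ∀ a → index a < suc (d * y)
  index<bound a = proj₁ (proj₂ (band a))
  conclude : (∃₂ λ a a′ → a < a′ × index a ≡ index a′) →
             ∃₂ λ m e → CloseAbove d p (y ^ e) (x ^ m) ⊎ CloseAbove d p (x ^ m) (y ^ e)
  conclude (a , a′ , a<a′ , same) =
    same-band⇒close {k = index a} {b = proj₁ (floor a)} {b′ = proj₁ (floor a′)} 1≤d (<⇒≤ 2≤x) (<⇒≤ 2≤y) distinct a<a′
      (proj₁ (proj₂ (floor a))) (proj₂ (proj₂ (floor a′)))
      (proj₂ (proj₂ (band a)))
      (subst (λ k → InBand d p k (y ^ proj₁ (floor a′)) (x ^ a′)) (sym same) (proj₂ (proj₂ (band a′))))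

prime≥2 : ∀ {q} → Prime q → 2 ≤ q
prime≥2 {q} pq = nonTrivial⇒n>1 q {{prime⇒nonTrivial pq}}

prime∤^ : ∀ {p q} → Prime p → Prime q → p ≢ q → ∀ v → ¬ p ∣ q ^ v
prime∤^ pp _ _ zero p∣1 = nonTrivial⇒≢1 {{prime⇒nonTrivial pp}} (∣1⇒≡1 p∣1)
prime∤^ {p} {q} pp pq p≢q (suc v) p∣q*qᵛ with euclidsLemma q (q ^ v) pp p∣q*qᵛ
... | inj₂ p∣qᵛ = prime∤^ pp pq p≢q v p∣qᵛ
... | inj₁ p∣q with prime⇒irreducible pq p∣q
...   | inj₁ p≡1 = nonTrivial⇒≢1 {{prime⇒nonTrivial pp}} p≡1
...   | inj₂ p≡q = p≢q p≡q

prime-powers-distinct : ∀ {p q} c c′ → 1 ≤ c → Prime p → Prime q → p ≢ q → PowersDistinct (p ^ c) (q ^ c′)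
prime-powers-distinct {p} {q} c c′ 1≤c pp pq p≢q m e 1≤m pᶜᵐ≡qᶜ′ᵉ =
  prime∤^ pp pq p≢q (c′ * e) (subst (p ∣_) (trans (sym (^-*-assoc p c m)) (trans pᶜᵐ≡qᶜ′ᵉ (^-*-assoc q c′ e)))
                                        (p∣p^ (c * m) (*-mono-≤ 1≤c 1≤m)))
  where
  p∣p^ : ∀ n → 1 ≤ n → p ∣ p ^ n
  p∣p^ (suc n) _ = m∣m*n (p ^ n)

halfTriple-positive : ∀ {q} → 2 ≤ q → 1 ≤ halfTriple q
halfTriple-positive {q@(suc r)} 2≤q =
  m≥n⇒m/n>0 {q * r * (q + 1)} {2} (≤-trans 2≤q (≤-trans (m≤m*n q r {{>-nonZero (≤-pred 2≤q)}}) (m≤m*n (q * r) (q + 1))))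

within-by-powers : ∀ {d p x y} C → 1 ≤ C → 1 ≤ x → 1 ≤ y → CloseAbove d p y x ⊎ CloseAbove d p x y →
  ∃[ n₀ ] ∀ n → n ≥ n₀ → ∃₂ λ k l → Within d p n (C * (x ^ k * y ^ l))
within-by-powers {y = y} C 1≤C _ 1≤y (inj₁ y<x) = C * y ^ (y * y) , eventually-within C 1≤C 1≤y y<x
within-by-powers {d} {p} {x} {y} C 1≤C 1≤x _ (inj₂ x<y) = C * x ^ (x * x) , λ n n≥ →
  let k , l , y-within = eventually-within C 1≤C 1≤x x<y n n≥
  in l , k , subst (Within d p n) (cong (C *_) (*-comm (y ^ k) (x ^ l))) y-within

Q-as-powers : ∀ q₁ q₂ m e k l →
  Q q₁ q₂ (suc (m * k)) (suc (e * l)) ≡ halfTriple q₁ * halfTriple q₂ * (((q₁ ^ 3) ^ m) ^ k * ((q₂ ^ 3) ^ e) ^ l)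
Q-as-powers q₁ q₂ m e k l = begin
  q₁ ^ (3 * (m * k)) * q₂ ^ (3 * (e * l)) * H₁ * H₂  ≡⟨ cong₂ (λ A B → A * B * H₁ * H₂) (pow q₁ m k) (pow q₂ e l) ⟨
  ((q₁ ^ 3) ^ m) ^ k * ((q₂ ^ 3) ^ e) ^ l * H₁ * H₂  ≡⟨ rotate (((q₁ ^ 3) ^ m) ^ k) (((q₂ ^ 3) ^ e) ^ l) H₁ H₂ ⟩
  H₁ * H₂ * (((q₁ ^ 3) ^ m) ^ k * ((q₂ ^ 3) ^ e) ^ l) ∎
  where
  open ≡-Reasoning
  H₁ = halfTriple q₁
  H₂ = halfTriple q₂
  pow : ∀ q m k → ((q ^ 3) ^ m) ^ k ≡ q ^ (3 * (m * k))
  pow q m k = trans (^-*-assoc (q ^ 3) m k) (^-*-assoc q 3 (m * k))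
  rotate : ∀ A B H₁ H₂ → A * B * H₁ * H₂ ≡ H₁ * H₂ * (A * B)
  rotate = solve-∀

Q-approximates : ∀ {q₁ q₂} → Prime q₁ → Prime q₂ → q₁ ≢ q₂ → ∀ d p → 1 ≤ d → 1 ≤ p →
  ∃[ n₀ ] ∀ n → n ≥ n₀ → ∃[ s ] ∃[ t ] s ≥ 1 × t ≥ 1 × Within d p n (Q q₁ q₂ s t)
Q-approximates {q₁} {q₂} pq₁ pq₂ q₁≢q₂ d p 1≤d 1≤p =
  let m , e , close = close-powers d p (cube≥2 pq₁) (cube≥2 pq₂) 1≤d 1≤p
                        (prime-powers-distinct 3 3 (s≤s z≤n) pq₁ pq₂ q₁≢q₂)
      n₀ , approx = within-by-powers C 1≤C (1≤^ m (<⇒≤ (cube≥2 pq₁))) (1≤^ e (<⇒≤ (cube≥2 pq₂))) close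
  in n₀ , λ n n≥n₀ →
    let k , l , Q-within = approx n n≥n₀
    in suc (m * k) , suc (e * l) , s≤s z≤n , s≤s z≤n , subst (Within d p n) (sym (Q-as-powers q₁ q₂ m e k l)) Q-within
  where
  C = halfTriple q₁ * halfTriple q₂
  1≤C : 1 ≤ C
  1≤C = *-mono-≤ (halfTriple-positive (prime≥2 pq₁)) (halfTriple-positive (prime≥2 pq₂))
  cube≥2 : ∀ {q} → Prime q → 2 ≤ q ^ 3
  cube≥2 pq = ≤-trans (s≤s (s≤s z≤n)) (^-monoˡ-≤ 3 (prime≥2 pq))

n/1≡mkℚ : ∀ n → + n / 1 ≡ mkℚ (+ n) 0 (coprime-sym (1-coprimeTo n))
n/1≡mkℚ n = normalize-coprime (coprime-sym (1-coprimeTo n))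

-- In unnormalised rationals the inequality cross-multiplies to the hypothesis.
ℕ-bound⇒ℚ-bound : ∀ {d p} .(c : Coprime (suc p) (suc d)) n x → suc d * x ≤ (suc d + suc p) * n →
  (+ x / 1) ℚ.≤ (1ℚ ℚ.+ mkℚ (+ suc p) d c) ℚ.* (+ n / 1)
ℕ-bound⇒ℚ-bound {d} {p} c n x bound = toℚᵘ-cancel-≤ (let open ℚᵘ.≤-Reasoning in begin
  toℚᵘ (+ x / 1)                               ≡⟨ cong toℚᵘ (n/1≡mkℚ x) ⟩
  ℚᵘ.mkℚᵘ (+ x) 0                              ≤⟨ ℚᵘ.*≤* cross-multiplied ⟩
  (toℚᵘ 1ℚ ℚᵘ.+ toℚᵘ μ) ℚᵘ.* ℚᵘ.mkℚᵘ (+ n) 0   ≡⟨ cong (λ r → (toℚᵘ 1ℚ ℚᵘ.+ toℚᵘ μ) ℚᵘ.* toℚᵘ r) (n/1≡mkℚ n) ⟨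
  (toℚᵘ 1ℚ ℚᵘ.+ toℚᵘ μ) ℚᵘ.* toℚᵘ (+ n / 1)    ≃⟨ ℚᵘ.*-congʳ (toℚᵘ-homo-+ 1ℚ μ) ⟨
  toℚᵘ (1ℚ ℚ.+ μ) ℚᵘ.* toℚᵘ (+ n / 1)          ≃⟨ toℚᵘ-homo-* (1ℚ ℚ.+ μ) (+ n / 1) ⟨
  toℚᵘ ((1ℚ ℚ.+ μ) ℚ.* (+ n / 1))              ∎)
  where
  μ = mkℚ (+ suc p) d c
  cross-multiplied : + x ℤ.* + (1 * suc d * 1) ℤ.≤ ((ℤ.1ℤ ℤ.* + suc d ℤ.+ + suc p ℤ.* ℤ.1ℤ) ℤ.* + n) ℤ.* ℤ.1ℤ
  cross-multiplied = begin
    + x ℤ.* + (1 * suc d * 1)      ≡⟨ ℤ.pos-* x (1 * suc d * 1) ⟨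
    + (x * (1 * suc d * 1))        ≡⟨ cong +_ (drop-units x (suc d)) ⟩
    + (suc d * x)                  ≤⟨ ℤ.+≤+ bound ⟩
    + ((suc d + suc p) * n)        ≡⟨ ℤ.pos-* (suc d + suc p) n ⟩
    + (suc d + suc p) ℤ.* + n      ≡⟨ cong (ℤ._* + n) (ℤ.pos-+ (suc d) (suc p)) ⟩
    (+ suc d ℤ.+ + suc p) ℤ.* + n  ≡⟨ drop-unitsℤ (+ suc d) (+ suc p) (+ n) ⟨
    ((ℤ.1ℤ ℤ.* + suc d ℤ.+ + suc p ℤ.* ℤ.1ℤ) ℤ.* + n) ℤ.* ℤ.1ℤ ∎
    where
    open ℤ.≤-Reasoning
    drop-units : ∀ x d → x * (1 * d * 1) ≡ d * x
    drop-units = solve-∀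
    drop-unitsℤ : ∀ a b c → ((ℤ.1ℤ ℤ.* a ℤ.+ b ℤ.* ℤ.1ℤ) ℤ.* c) ℤ.* ℤ.1ℤ ≡ (a ℤ.+ b) ℤ.* c
    drop-unitsℤ a b c = trans (ℤ.*-identityʳ _) (cong (ℤ._* c) (cong₂ ℤ._+_ (ℤ.*-identityˡ a) (ℤ.*-identityʳ b)))

lemma2p2 : (q₁ q₂ : ℕ) → Prime q₁ → Prime q₂ → q₁ ≢ q₂ →
    (μ : ℚ) → Positive μ →
    ∃[ n₀ ] ((n : ℕ) → n ≥ n₀ →
      ∃[ s ] ∃[ t ] (s ≥ 1 × t ≥ 1 × n ≤ Q q₁ q₂ s t ×
        ((+ Q q₁ q₂ s t) / 1) ℚ.≤ ((1ℚ ℚ.+ μ) ℚ.* ((+ n) / 1))))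
lemma2p2 q₁ q₂ pq₁ pq₂ q₁≢q₂ (mkℚ (+ suc p) d c) _ =
  let n₀ , approximation = Q-approximates pq₁ pq₂ q₁≢q₂ (suc d) (suc p) (s≤s z≤n) (s≤s z≤n)
  in n₀ , λ n n≥n₀ →
    let s , t , s≥1 , t≥1 , within n≤Q bound = approximation n n≥n₀
    in s , t , s≥1 , t≥1 , n≤Q , ℕ-bound⇒ℚ-bound c n (Q q₁ q₂ s t) bound
lemma2p2 _ _ _ _ _ (mkℚ +0 _ _) ()
lemma2p2 _ _ _ _ _ (mkℚ -[1+ _ ] _ _) ()
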